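{- Let $G$ be a finite simple graph with $V(G)=[n]$, $\gamma$ a choice function, $F$ a spanning forest of $G$, and $R(G;F)$ the set of $F$-redundant edges of $G$. Let $H$ be a subgraph of $G$ with $V(H)=V(G)$ and $E(F)\subseteq E(H)$. Then $\Psi_{\gamma,G}(F)=\Psi_{\gamma,H}(F)$ if and only if $E(G)\setminus R(G;F)\subseteq E(H)\subseteq E(G)$.
   Context: $V(G)=[n]$ is ordered as integers. A subforest of $G$ is a subgraph (not necessarily containing all vertices) without cycles; $\mathrm{Leaf}(F)$ is its set of degree-$1$ vertices. A choice function $\gamma$ assigns to each pair $(F,W)$, with $F$ a subforest of $G$ and $W$ a nonempty subset of $\mathrm{Leaf}(F)$ or a set consisting of one isolated vertex of $F$, an element $\gamma(F,W)\in W$. A spanning forest is an acyclic subgraph with vertex set $V(G)$; roots are the least vertices of the tree components; for a non-root $v$, $v^p$ is its neighbor on the path to its root. Algorithm B: for a graph $K$ on $[n]$ containing the spanning forest $F$ (roots $r_1=1<\dots<r_k$): define an ordering $v_1,\dots,v_n$ of $[n]$ ($\pi(i)=v_i$) by $v_1=1$ and, given $V_i=\{v_1,\dots,v_i\}$: if no edge of $F$ joins $V_i$ to its complement, $v_{i+1}$ is the smallest vertex not in $V_i$; otherwise let $W$ be the set of vertices outside $V_i$ joined by an $F$-edge to $V_i$, $F'$ the restriction of $F$ to $V_i\cup W$, and $v_{i+1}=\gamma(F',W)$. Then $\Psi_{\gamma,K}(F)$ is the function $f$ with $f(r_j)=\infty$ for roots and $f(v)=\#\{u:\{v,u\}\in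 E(K),\ \pi^{ -1}(u)<\pi^{ -1}(v^p)\}$ for non-roots. An edge $e\in E(G)\setminus E(F)$ is $F$-redundant if $\Psi_{\gamma,G-e}(F)=\Psi_{\gamma,G}(F)$. -}

module Defs where

open import Data.Bool using (Bool; true; false; _∧_; _∨_; not; if_then_else_)
open import Data.Nat using (ℕ; zero; suc; _+_; _<ᵇ_; _≤_)
open import Data.Fin using (Fin; zero; suc; _≟_)
open import Data.Fin.Subset using (Subset; _∈_; _∉_; _∪_; ⁅_⁆; _⊆_; Nonempty)
import Data.Fin.Subset as Sub
open import Data.Vec using (Vec; lookup; tabulate)
open import Data.List using (List; []; _∷_; length; [_]; _++_)
open import Data.List.Relation.Unary.Unique.Propositional using (Unique)
open import Data.Maybe using (Maybe; just; nothing; fromMaybe)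
open import Data.Product using (_×_; ∃)
open import Data.Sum using (_⊎_)
open import Data.Unit using (⊤)
open import Relation.Nullary using (¬_; ⌊_⌋)
open import Relation.Binary.PropositionalEquality using (_≡_; _≗_)
open import Function using (_∘_)

-- Vertices: [n] is modelled by Fin n, ordered by the usual order
-- (vertex 1 of the paper is `zero`).
-- Graphs on [n] (and their edge sets) are adjacency matrices.

Adj : ℕ → Set
Adj n = Vec (Vec Bool n) n

adj : ∀ {n} → Adj n → Fin n → Fin n → Bool
adj A u v = lookup (lookup A u) v

Edge : ∀ {n} → Adj n → Fin n → Fin n → Set
Edge A u v = adj A u v ≡ true

IsSimpleGraph : ∀ {n} → Adj n → Set
IsSimpleGraph A = (∀ u v → adj A u v ≡ adj A v u) × (∀ u → adj A u u ≡ false)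

_⊆ₑ_ : ∀ {n} → Adj n → Adj n → Set
A ⊆ₑ B = ∀ u v → Edge A u v → Edge B u v

removeEdge : ∀ {n} → Adj n → Fin n → Fin n → Adj n
removeEdge A a b = tabulate λ u → tabulate λ v →
  adj A u v ∧ not ((⌊ u ≟ a ⌋ ∧ ⌊ v ≟ b ⌋) ∨ (⌊ u ≟ b ⌋ ∧ ⌊ v ≟ a ⌋))

countF : ∀ {n} → (Fin n → Bool) → ℕ
countF {zero}  p = 0
countF {suc n} p = (if p zero then 1 else 0) + countF (p ∘ suc)

anyF : ∀ {n} → (Fin n → Bool) → Bool
anyF {zero}  p = false
anyF {suc n} p = p zero ∨ anyF (p ∘ suc)

firstF : ∀ {n} → (Fin n → Bool) → Maybe (Fin n)
firstF {zero}  p = nothing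
firstF {suc n} p = if p zero then just zero else Data.Maybe.map suc (firstF (p ∘ suc))
  where import Data.Maybe

Chain : ∀ {n} → Adj n → List (Fin n) → Set
Chain A []           = ⊤
Chain A (x ∷ [])     = ⊤
Chain A (x ∷ y ∷ ys) = Edge A x y × Chain A (y ∷ ys)

IsCycle : ∀ {n} → Adj n → List (Fin n) → Set
IsCycle A []       = Data.Empty.⊥
  where import Data.Empty
IsCycle A (x ∷ xs) = 3 ≤ length (x ∷ xs) × Unique (x ∷ xs) × Chain A (x ∷ xs ++ [ x ])

Acyclic : ∀ {n} → Adj n → Set
Acyclic A = ∀ xs → ¬ IsCycle A xs

-- F is a spanning forest of G (vertex set is automatically [n])
IsSpanningForest : ∀ {n} → Adj n → Adj n → Set
IsSpanningForest G F = IsSimpleGraph F × F ⊆ₑ G × Acyclic F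

degree : ∀ {n} → Adj n → Fin n → ℕ
degree A v = countF (adj A v)

IsSubforest : ∀ {n} → Adj n → Subset n → Adj n → Set
IsSubforest G S A = IsSimpleGraph A × A ⊆ₑ G × Acyclic A
                  × (∀ u v → Edge A u v → u ∈ S × v ∈ S)

IsLeaf : ∀ {n} → Subset n → Adj n → Fin n → Set
IsLeaf S A v = v ∈ S × degree A v ≡ 1

IsIsolated : ∀ {n} → Subset n → Adj n → Fin n → Set
IsIsolated S A v = v ∈ S × degree A v ≡ 0

Admissible : ∀ {n} → Adj n → Subset n → Adj n → Subset n → Set
Admissible G S A W = IsSubforest G S A ×
  ((Nonempty W × (∀ v → v ∈ W → IsLeaf S A v))
   ⊎ ∃ λ v → W ≡ ⁅ v ⁆ × IsIsolated S A v)

-- γ (S , A) W ; its values outside admissible arguments are irrelevant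
ChoiceFn : ℕ → Set
ChoiceFn n = Subset n → Adj n → Subset n → Fin n

IsChoiceFunction : ∀ {n} → Adj n → ChoiceFn n → Set
IsChoiceFunction G γ = ∀ S A W → Admissible G S A W → γ S A W ∈ W

-- Connectivity: u and w joined by a walk in A (walks of length ≤ n suffice)

reachStep : ∀ {n} → Adj n → Adj n → Adj n
reachStep A R = tabulate λ u → tabulate λ w →
  adj R u w ∨ anyF (λ x → adj R u x ∧ adj A x w)

reachIter : ∀ {n} → ℕ → Adj n → Adj n
reachIter zero    A = tabulate λ u → tabulate λ w → ⌊ u ≟ w ⌋
reachIter (suc k) A = reachStep A (reachIter k A)

conn : ∀ {n} → Adj n → Fin n → Fin n → Bool
conn {n} A u w = adj (reachIter n A) u w

deleteVertex : ∀ {n} → Adj n → Fin n → Adj n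
deleteVertex A v = tabulate λ a → tabulate λ b →
  not ⌊ a ≟ v ⌋ ∧ not ⌊ b ≟ v ⌋ ∧ adj A a b

rootOf : ∀ {n} → Adj n → Fin n → Fin n
rootOf F v = fromMaybe v (firstF (λ u → conn F u v))

isRoot : ∀ {n} → Adj n → Fin n → Bool
isRoot F v = ⌊ rootOf F v ≟ v ⌋

-- v^p: the neighbour u of v on the path from v to its root, i.e. the
-- neighbour u joined to the root by a path avoiding v
parentOf : ∀ {n} → Adj n → Fin n → Fin n
parentOf F v = fromMaybe v
  (firstF (λ u → adj F v u ∧ conn (deleteVertex F v) u (rootOf F v)))

module _ {n : ℕ} (γ : ChoiceFn n) (F : Adj n) where

  frontier : Subset n → Subset n
  frontier V = tabulate λ w →
    not (lookup V w) ∧ anyF (λ u → lookup V u ∧ adj F u w)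

  restrictTo : Subset n → Adj n
  restrictTo S = tabulate λ u → tabulate λ v → lookup S u ∧ lookup S v ∧ adj F u v

  nextVertex : Subset n → Maybe (Fin n)
  nextVertex V with anyF (lookup (frontier V))
  ... | true  = just (γ (V ∪ frontier V) (restrictTo (V ∪ frontier V)) (frontier V))
  ... | false = firstF (λ w → not (lookup V w))

  -- starting from V₀ = ∅ this gives v₁ = 1 (the least vertex)
  orderFrom : ℕ → Subset n → List (Fin n)
  orderFrom zero    V = []
  orderFrom (suc k) V with nextVertex V
  ... | nothing = []
  ... | just v  = v ∷ orderFrom k (V ∪ ⁅ v ⁆)

  ordering : List (Fin n)
  ordering = orderFrom n Sub.⊥

-- position (π⁻¹) of u in a list, counted from 1
position : ∀ {n} → List (Fin n) → Fin n → ℕ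
position []       u = 1
position (x ∷ xs) u = if ⌊ x ≟ u ⌋ then 1 else suc (position xs u)

data ℕ∞ : Set where
  fin : ℕ → ℕ∞
  ∞   : ℕ∞

Ψ : ∀ {n} → ChoiceFn n → Adj n → Adj n → Fin n → ℕ∞
Ψ γ K F v = if isRoot F v then ∞ else
  fin (countF (λ u → adj K v u ∧ (position π u <ᵇ position π (parentOf F v))))
  where π = ordering γ F

Redundant : ∀ {n} → ChoiceFn n → Adj n → Adj n → Fin n → Fin n → Set
Redundant γ G F u v = Edge G u v × ¬ Edge F u v
                    × (Ψ γ (removeEdge G u v) F ≗ Ψ γ G F)

-- Ψ_{γ,K}(F)(w) counts the K-neighbours x of a non-root w that precede w's parent in the
-- ordering of Algorithm B, which depends on γ and F only.  Hence for K ⊆ K' the two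
-- functions agree iff every pair (w , x) counted for K' is an edge of K, and an edge is
-- F-redundant exactly when neither endpoint counts the other.  So Ψ_{γ,H}(F) = Ψ_{γ,G}(F)
-- iff H contains every edge of G counted by one of its endpoints, i.e. every non-redundant one.
module Submission where

open import Defs
open import Data.Bool using (Bool; true; false; _∧_; _∨_; not)
open import Data.Bool.Properties using (∧-conicalˡ; ∧-conicalʳ) renaming (_≟_ to _≟ᵇ_)
open import Data.Empty using (⊥-elim)
open import Data.Fin using (Fin; zero; suc; _≟_)
open import Data.Nat using (ℕ; zero; suc; _≤_; _<_; _<ᵇ_; z≤n; s≤s)
open import Data.Nat.Properties using (≤-antisym; <-irrefl; ≤-trans; n≤1+n)
open import Data.Product using (_×_; _,_; proj₁; proj₂)
open import Data.Sum using (_⊎_; inj₁; inj₂)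
open import Data.Vec using (lookup)
open import Data.Vec.Properties using (lookup∘tabulate)
open import Function using (_∘_)
open import Function.Bundles using (_⇔_; mk⇔; Equivalence)
open import Relation.Nullary using (¬_; Dec; yes; no; does; ⌊_⌋)
open import Relation.Nullary.Decidable using (_×-dec_; _⊎-dec_; isYes≗does; decidable-stable)
open import Relation.Binary.PropositionalEquality
  using (_≡_; refl; _≗_; sym; trans; cong; cong₂; module ≡-Reasoning)

open Equivalence using (to; from)

_⊆ᵇ_ : ∀ {n} → (Fin n → Bool) → (Fin n → Bool) → Set
p ⊆ᵇ q = ∀ x → p x ≡ true → q x ≡ true

countF-mono : ∀ {n} {p q : Fin n → Bool} → p ⊆ᵇ q → countF p ≤ countF q
countF-mono {zero}  p⊆q = z≤n
countF-mono {suc n} {p} {q} p⊆q with p zero in p₀ | q zero in q₀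
... | true  | true  = s≤s (countF-mono (p⊆q ∘ suc))
... | false | true  = ≤-trans (countF-mono (p⊆q ∘ suc)) (n≤1+n _)
... | false | false = countF-mono (p⊆q ∘ suc)
... | true  | false with () ← trans (sym (p⊆q zero p₀)) q₀

countF-mono-< : ∀ {n} {p q : Fin n → Bool} → p ⊆ᵇ q →
                ∀ x → p x ≡ false → q x ≡ true → countF p < countF q
countF-mono-< p⊆q zero p₀ q₀ rewrite p₀ | q₀ = s≤s (countF-mono (p⊆q ∘ suc))
countF-mono-< {p = p} {q} p⊆q (suc x) px qx with p zero in p₀ | q zero in q₀
... | true  | true  = s≤s (countF-mono-< (p⊆q ∘ suc) x px qx)
... | false | true  = ≤-trans (countF-mono-< (p⊆q ∘ suc) x px qx) (n≤1+n _)
... | false | false = countF-mono-< (p⊆q ∘ suc) x px qx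
... | true  | false with () ← trans (sym (p⊆q zero p₀)) q₀

countF-≡⇒⊇ : ∀ {n} {p q : Fin n → Bool} → p ⊆ᵇ q → countF p ≡ countF q → q ⊆ᵇ p
countF-≡⇒⊇ {p = p} p⊆q #p≡#q x qx with p x in px
... | true  = refl
... | false = ⊥-elim (<-irrefl #p≡#q (countF-mono-< p⊆q x px qx))

fin-injective : ∀ {m n} → fin m ≡ fin n → m ≡ n
fin-injective refl = refl

SameEdge : ∀ {n} → Fin n → Fin n → Fin n → Fin n → Set
SameEdge u v w x = (w ≡ u × x ≡ v) ⊎ (w ≡ v × x ≡ u)

adj-removeEdge : ∀ {n} (G : Adj n) u v w x →
  adj (removeEdge G u v) w x ≡ adj G w x ∧ not (does ((w ≟ u ×-dec x ≟ v) ⊎-dec (w ≟ v ×-dec x ≟ u)))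
adj-removeEdge G u v w x = begin
  adj (removeEdge G u v) w x
    ≡⟨ cong (λ row → lookup row x) (lookup∘tabulate _ w) ⟩
  _ ≡⟨ lookup∘tabulate _ x ⟩
  adj G w x ∧ not ((⌊ w ≟ u ⌋ ∧ ⌊ x ≟ v ⌋) ∨ (⌊ w ≟ v ⌋ ∧ ⌊ x ≟ u ⌋))
    ≡⟨ cong (λ b → adj G w x ∧ not b) (cong₂ _∨_ (cong₂ _∧_ (isYes≗does (w ≟ u)) (isYes≗does (x ≟ v)))
                                                  (cong₂ _∧_ (isYes≗does (w ≟ v)) (isYes≗does (x ≟ u)))) ⟩
  adj G w x ∧ not (does ((w ≟ u ×-dec x ≟ v) ⊎-dec (w ≟ v ×-dec x ≟ u))) ∎
  where open ≡-Reasoning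

∧-not-does≡true⇔ : ∀ {P : Set} (b : Bool) (P? : Dec P) → (b ∧ not (does P?) ≡ true) ⇔ (b ≡ true × ¬ P)
∧-not-does≡true⇔ false _       = mk⇔ (λ ()) proj₁
∧-not-does≡true⇔ true  (yes p) = mk⇔ (λ ()) (λ (_ , ¬p) → ⊥-elim (¬p p))
∧-not-does≡true⇔ true  (no ¬p) = mk⇔ (λ _ → refl , ¬p) proj₁

Edge-removeEdge : ∀ {n} (G : Adj n) u v w x →
  Edge (removeEdge G u v) w x ⇔ (Edge G w x × ¬ SameEdge u v w x)
Edge-removeEdge G u v w x rewrite adj-removeEdge G u v w x =
  ∧-not-does≡true⇔ (adj G w x) ((w ≟ u ×-dec x ≟ v) ⊎-dec (w ≟ v ×-dec x ≟ u))

module _ {n : ℕ} (γ : ChoiceFn n) (F : Adj n) where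

  precedesParent : Fin n → Fin n → Bool
  precedesParent w x = position (ordering γ F) x <ᵇ position (ordering γ F) (parentOf F w)

  counted : Adj n → Fin n → Fin n → Bool
  counted K w x = adj K w x ∧ precedesParent w x

  -- a record rather than a product, so that K, w and x can be inferred from a proof of it
  record Counts (K : Adj n) (w x : Fin n) : Set where
    constructor counts
    field
      nonroot   : isRoot F w ≡ false
      isCounted : counted K w x ≡ true

  Ψ-nonroot : ∀ K w → isRoot F w ≡ false → Ψ γ K F w ≡ fin (countF (counted K w))
  Ψ-nonroot K w r rewrite r = refl

  Counts⇒Edge : ∀ {K w x} → Counts K w x → Edge K w x
  Counts⇒Edge (counts _ c) = ∧-conicalˡ _ _ c

  counted-edge : ∀ {K K' w x} → Edge K w x → counted K' w x ≡ true → counted K w x ≡ true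
  counted-edge {w = w} {x} e c = trans (cong (_∧ precedesParent w x) e) (∧-conicalʳ _ _ c)

  Counts-edge : ∀ {K K' w x} → Edge K w x → Counts K' w x → Counts K w x
  Counts-edge {K} {K'} e (counts r c) = counts r (counted-edge {K} {K'} e c)

  counted-mono : ∀ K K' → K ⊆ₑ K' → ∀ w → counted K w ⊆ᵇ counted K' w
  counted-mono K K' K⊆K' w x c = counted-edge {K'} {K} (K⊆K' w x (∧-conicalˡ _ _ c)) c

  Ψ-≗⇔ : ∀ K K' → K ⊆ₑ K' → (Ψ γ K F ≗ Ψ γ K' F) ⇔ (∀ w x → Counts K' w x → Counts K w x)
  Ψ-≗⇔ K K' K⊆K' = mk⇔ agree⇒ ⇒agree
    where
    agree⇒ : Ψ γ K F ≗ Ψ γ K' F → ∀ w x → Counts K' w x → Counts K w x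
    agree⇒ Ψ≗ w x (counts r c) = counts r (countF-≡⇒⊇ (counted-mono K K' K⊆K' w) #≡ x c)
      where
      #≡ : countF (counted K w) ≡ countF (counted K' w)
      #≡ = fin-injective (trans (sym (Ψ-nonroot K w r)) (trans (Ψ≗ w) (Ψ-nonroot K' w r)))
    ⇒agree : (∀ w x → Counts K' w x → Counts K w x) → Ψ γ K F ≗ Ψ γ K' F
    ⇒agree preserved w with isRoot F w in r
    ... | true  = refl
    ... | false = cong fin (≤-antisym (countF-mono (counted-mono K K' K⊆K' w))
                                      (countF-mono (λ x c → Counts.isCounted (preserved w x (counts r c)))))

  Ψ-removeEdge-≗⇔ : ∀ G u v → (Ψ γ (removeEdge G u v) F ≗ Ψ γ G F) ⇔ (¬ Counts G u v × ¬ Counts G v u)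
  Ψ-removeEdge-≗⇔ G u v =
    mk⇔ (λ Ψ≗ → let keeps = to (Ψ-≗⇔ (removeEdge G u v) G removeEdge-⊆) Ψ≗ in
               (λ c → removes (inj₁ (refl , refl)) (keeps u v c))
             , (λ c → removes (inj₂ (refl , refl)) (keeps v u c)))
        (λ (¬uv , ¬vu) → from (Ψ-≗⇔ (removeEdge G u v) G removeEdge-⊆) λ w x c →
           Counts-edge (from (Edge-removeEdge G u v w x) (Counts⇒Edge c , λ where
             (inj₁ (refl , refl)) → ¬uv c
             (inj₂ (refl , refl)) → ¬vu c)) c)
    where
    removeEdge-⊆ : removeEdge G u v ⊆ₑ G
    removeEdge-⊆ w x e = proj₁ (to (Edge-removeEdge G u v w x) e)
    removes : ∀ {w x} → SameEdge u v w x → ¬ Counts (removeEdge G u v) w x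
    removes same c = proj₂ (to (Edge-removeEdge G u v _ _) (Counts⇒Edge c)) same

  Counts⇒¬Redundant : ∀ {G u v} → Counts G u v → ¬ Redundant γ G F u v
  Counts⇒¬Redundant {G} {u} {v} c (_ , _ , Ψ≗) = proj₁ (to (Ψ-removeEdge-≗⇔ G u v) Ψ≗) c

  missing⇒Redundant : ∀ {G H} → IsSimpleGraph H → F ⊆ₑ H → (∀ w x → Counts G w x → Counts H w x) →
                      ∀ {u v} → Edge G u v → ¬ Edge H u v → Redundant γ G F u v
  missing⇒Redundant {G} {H} (symmetric , _) F⊆H keeps {u} {v} uv ¬uv =
    uv , ¬uv ∘ F⊆H u v , from (Ψ-removeEdge-≗⇔ G u v)
      ( (λ c → ¬uv (Counts⇒Edge (keeps u v c)))
      , (λ c → ¬uv (trans (symmetric u v) (Counts⇒Edge (keeps v u c)))))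

theorem4p1 : ∀ {n : ℕ} (G : Adj n) → IsSimpleGraph G
    → (γ : ChoiceFn n) → IsChoiceFunction G γ
    → (F : Adj n) → IsSpanningForest G F
    → (H : Adj n) → IsSimpleGraph H → H ⊆ₑ G → F ⊆ₑ H
    → (Ψ γ G F ≗ Ψ γ H F)
      ⇔ ((∀ (u v : Fin n) → Edge G u v → ¬ Redundant γ G F u v → Edge H u v) × H ⊆ₑ G)
theorem4p1 G _ γ _ F _ H simpleH H⊆G F⊆H = mk⇔ (λ Ψ≗ → keepsNonRedundant Ψ≗ , H⊆G) agree
  where
  NonRedundant⊆H : Set
  NonRedundant⊆H = ∀ u v → Edge G u v → ¬ Redundant γ G F u v → Edge H u v

  keepsNonRedundant : Ψ γ G F ≗ Ψ γ H F → NonRedundant⊆H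
  keepsNonRedundant Ψ≗ u v uv nonRedundant = decidable-stable (adj H u v ≟ᵇ true)
    (nonRedundant ∘ missing⇒Redundant γ F simpleH F⊆H (to (Ψ-≗⇔ γ F H G H⊆G) (sym ∘ Ψ≗)) uv)

  agree : NonRedundant⊆H × H ⊆ₑ G → Ψ γ G F ≗ Ψ γ H F
  agree (nonRedundant⊆H , _) = sym ∘ from (Ψ-≗⇔ γ F H G H⊆G) λ w x c →
    Counts-edge γ F (nonRedundant⊆H w x (Counts⇒Edge γ F c) (Counts⇒¬Redundant γ F c)) c
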